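{- Let $p$ be a positive integer. For $n\ge 0$, let $\mathcal{B}^{(p)}_n$ denote the set of $p$-Fibonacci polyominoes with $n$ columns (with $\mathcal{B}^{(p)}_0$ consisting only of the empty polyomino), and define \[G_p(x;q)=\sum_{n\ge 0}x^n\sum_{P\in\mathcal{B}^{(p)}_n} q^{\mathrm{inn}(P)}.\] Then \[G_p(x;q)=1+\frac{\sum_{i=1}^{p}x^{p-i+1}q^{\frac12(p-i)(p+i-3)}}{1-\sum_{i=1}^{p}x^{p-i+1}q^{\frac12\left((p-i)(p+i-3)+2(i-1)\right)}}.\]
   Context: A $p$-Fibonacci word of length $n\ge 1$ is a word $u=u_1u_2\cdots u_n$ over $\{1,\dots,p\}$ with $u_1=p$ and, for $1\le i\le n-1$: if $u_i=1$ then $u_{i+1}=p$; if $2\le u_i\le p$ then $u_{i+1}\in\{u_i-1,\,p\}$. The empty word is the unique $p$-Fibonacci word of length $0$. Each such word $u$ determines a polyomino (bargraph) with $n$ columns: $n$ adjacent columns of unit square cells resting on a common horizontal base line, the $i$-th column having $u_i$ cells; these are the $p$-Fibonacci polyominoes. An inner point of a polyomino $P$ is a lattice point that does not lie on the boundary of $P$, equivalently a lattice point that is a corner of exactly four cells of $P$; $\mathrm{inn}(P)$ denotes the number of inner points of $P$ (the empty polyomino has $0$ inner points). -}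

module Defs where

open import Data.Nat using (ℕ; zero; suc; _+_; _*_; _∸_; _⊔_; _≡ᵇ_; _<ᵇ_; _/_)
open import Data.Bool using (Bool; true; false; _∧_; _∨_; if_then_else_)
open import Data.List using (List; []; _∷_; map; concatMap; upTo; length; filter; foldr)
open import Data.Integer as ℤ using (ℤ)
open import Relation.Binary.PropositionalEquality using (_≡_)
open import Data.Bool using (T)
open import Relation.Nullary.Decidable using (Dec)
open import Data.Bool.Properties using (T?)

words : ℕ → ℕ → List (List ℕ)
words p zero    = [] ∷ []
words p (suc n) = concatMap (λ a → map (a ∷_) (words p n)) (map suc (upTo p))

fibStep : ℕ → ℕ → ℕ → Bool
fibStep p a b = if a ≡ᵇ 1 then b ≡ᵇ p else ((b ≡ᵇ (a ∸ 1)) ∨ (b ≡ᵇ p))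

fibChain : ℕ → ℕ → List ℕ → Bool
fibChain p a []      = true
fibChain p a (b ∷ w) = fibStep p a b ∧ fibChain p b w

isFib : ℕ → List ℕ → Bool
isFib p []      = true
isFib p (a ∷ w) = (a ≡ᵇ p) ∧ fibChain p a w

-- 𝓑^(p)_n : the p-Fibonacci words (= polyominoes) with n columns.
Fib : ℕ → ℕ → List (List ℕ)
Fib p n = filter (λ w → T? (isFib p w)) (words p n)

-- height of column c (0-based); 0 outside the word
height : List ℕ → ℕ → ℕ
height []      c       = 0
height (h ∷ w) zero    = h
height (h ∷ w) (suc c) = height w c

-- the unit cell [c,c+1]×[r,r+1] belongs to the polyomino
cell : List ℕ → ℕ → ℕ → Bool
cell w c r = r <ᵇ height w c

maxH : List ℕ → ℕ
maxH = foldr _⊔_ 0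

-- lattice point (a,b) is a corner of exactly four cells of the polyomino
-- (the four cells having (a,b) as a corner are (a-1,b-1),(a,b-1),(a-1,b),(a,b))
innerAt : List ℕ → ℕ → ℕ → Bool
innerAt w zero    b       = false
innerAt w (suc a) zero    = false
innerAt w (suc a) (suc b) =
  cell w a b ∧ cell w (suc a) b ∧ cell w a (suc b) ∧ cell w (suc a) (suc b)

count : List Bool → ℕ
count []          = 0
count (true ∷ l)  = suc (count l)
count (false ∷ l) = count l

-- number of inner points; every inner point (a,b) has 1 ≤ a ≤ length w, 1 ≤ b ≤ maxH w,
-- so counting over that box counts all inner points.
inn : List ℕ → ℕ
inn w = count (concatMap (λ a → map (λ b → innerAt w a b) (upTo (suc (maxH w))))
                         (upTo (suc (length w))))

-- Formal power series in x,q with integer coefficients: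
-- s n k = coefficient of x^n q^k.

Series : Set
Series = ℕ → ℕ → ℤ

_≈_ : Series → Series → Set
f ≈ g = ∀ n k → f n k ≡ g n k

sumTo : ℕ → (ℕ → ℤ) → ℤ
sumTo zero    f = f 0
sumTo (suc n) f = sumTo n f ℤ.+ f (suc n)

_⊕_ : Series → Series → Series
(f ⊕ g) n k = f n k ℤ.+ g n k

_⊖_ : Series → Series → Series
(f ⊖ g) n k = f n k ℤ.- g n k

_⊛_ : Series → Series → Series
(f ⊛ g) n k = sumTo n (λ i → sumTo k (λ j → f i j ℤ.* g (n ∸ i) (k ∸ j)))

mono : ℕ → ℕ → Series
mono a b n k = if (n ≡ᵇ a) ∧ (k ≡ᵇ b) then ℤ.+ 1 else ℤ.+ 0

one : Series
one = mono 0 0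

zeroS : Series
zeroS n k = ℤ.+ 0

sumSeries : ℕ → (ℕ → Series) → Series
sumSeries zero    f = zeroS
sumSeries (suc p) f = sumSeries p f ⊕ f (suc p)

countInn : ℕ → ℕ → ℕ → ℕ
countInn p n k = length (filter (λ w → Data.Nat._≟_ (inn w) k) (Fib p n))

G : ℕ → Series
G p n k = ℤ.+ (countInn p n k)

Num : ℕ → Series
Num p = sumSeries p (λ i → mono (p ∸ i + 1) (((p ∸ i) * (p + i ∸ 3)) / 2))

Den : ℕ → Series
Den p = sumSeries p (λ i → mono (p ∸ i + 1) (((p ∸ i) * (p + i ∸ 3) + 2 * (i ∸ 1)) / 2))

-- After a letter i a p-Fibonacci word continues with i - 1 or restarts at p, so a nonempty
-- word is a sequence of descending runs p, p - 1, …, i.  Such a run has p - i + 1 columns and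
-- (p - i)(p + i - 3)/2 inner points, and the step from its last column (height i) up to the
-- next one (height p) adds i - 1 more.  Splitting off the first run, the series S of nonempty
-- words satisfies S = Num + Den S.  If H = 1 + Den H then Num H solves the same equation, and
-- since Den is divisible by x the solution is unique: G = 1 + S = 1 + Num H and H (1 - Den) = 1.
-- The computation is done with natural coefficients, where multiplying by a monomial shifts
-- the indices, and transported to integer series at the end.

module Submission where

open import Data.Bool using (Bool; true; false; _∧_; _∨_; if_then_else_)
open import Data.Bool.Properties using (∧-zeroʳ; if-float; T?)
open import Data.Integer as ℤ using (ℤ)
import Data.Integer.Properties as ℤ
open import Data.List using (List; []; _∷_; _++_; map; concatMap; applyUpTo; upTo; length; filter)
open import Data.List.Properties using (map-cong; map-∘; map-upTo; map-concatMap)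
open import Data.Nat using (ℕ; zero; suc; _+_; _*_; _∸_; _⊓_; _≡ᵇ_; _<ᵇ_; _≤_; _<_; z≤n; s≤s; _/_; _≟_)
open import Data.Nat.Induction using (<-rec)
open import Data.Product using (Σ; _×_; _,_; proj₁; proj₂)
open import Data.Nat.DivMod using (m*n/n≡m)
open import Data.Nat.ListAction using (sum)
open import Data.Nat.Properties
open import Data.Nat.Tactic.RingSolver using (solve)
open import Algebra.Properties.CommutativeSemigroup +-commutativeSemigroup
  using () renaming (interchange to +-interchange)
open import Algebra.Properties.CommutativeSemigroup ℤ.+-commutativeSemigroup
  using () renaming (interchange to +ℤ-interchange)
open import Function using (_∘_)
open import Level using (Level)
open import Relation.Binary.PropositionalEquality
open import Relation.Nullary using (does)
open import Relation.Unary using (Pred; Decidable)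

open import Defs

count-++ : ∀ xs ys → count (xs ++ ys) ≡ count xs + count ys
count-++ []           ys = refl
count-++ (true ∷ xs)  ys = cong suc (count-++ xs ys)
count-++ (false ∷ xs) ys = count-++ xs ys

count-concatMap : ∀ {A : Set} (f : A → List Bool) xs →
                  count (concatMap f xs) ≡ sum (map (count ∘ f) xs)
count-concatMap f []       = refl
count-concatMap f (x ∷ xs) =
  trans (count-++ (f x) (concatMap f xs)) (cong (count (f x) +_) (count-concatMap f xs))

count-map-false : ∀ {A : Set} (xs : List A) → count (map (λ _ → false) xs) ≡ 0
count-map-false []       = refl
count-map-false (x ∷ xs) = count-map-false xs

count-map-∧ : ∀ {A : Set} b (P Q : A → Bool) xs →
              count (map (λ x → (b ∧ P x) ∧ Q x) xs) ≡ (if b then count (map (λ x → P x ∧ Q x) xs) else 0)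
count-map-∧ true  P Q xs = refl
count-map-∧ false P Q xs = count-map-false xs

length-filter-filter : ∀ {A : Set} {ℓ₁ ℓ₂ : Level} {P : Pred A ℓ₁} {Q : Pred A ℓ₂}
                       (P? : Decidable P) (Q? : Decidable Q) xs →
                       length (filter Q? (filter P? xs)) ≡ count (map (λ x → does (P? x) ∧ does (Q? x)) xs)
length-filter-filter P? Q? []       = refl
length-filter-filter P? Q? (x ∷ xs) with does (P? x)
... | false = length-filter-filter P? Q? xs
... | true with does (Q? x)
...   | false = length-filter-filter P? Q? xs
...   | true  = cong suc (length-filter-filter P? Q? xs)

applyUpTo-cong : ∀ {A : Set} {f g : ℕ → A} → (∀ i → f i ≡ g i) → ∀ n → applyUpTo f n ≡ applyUpTo g n
applyUpTo-cong f≗g zero    = refl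
applyUpTo-cong f≗g (suc n) = cong₂ _∷_ (f≗g 0) (applyUpTo-cong (f≗g ∘ suc) n)

sum-applyUpTo-zero : ∀ n → sum (applyUpTo (λ _ → 0) n) ≡ 0
sum-applyUpTo-zero zero    = refl
sum-applyUpTo-zero (suc n) = sum-applyUpTo-zero n

sum-indicator : ∀ (f : ℕ → ℕ) {s n} → s < n →
                sum (applyUpTo (λ i → if i ≡ᵇ s then f i else 0) n) ≡ f s
sum-indicator f {zero}  {suc n} _         = trans (cong (f 0 +_) (sum-applyUpTo-zero n)) (+-identityʳ (f 0))
sum-indicator f {suc s} {suc n} (s≤s s<n) = sum-indicator (f ∘ suc) s<n

sum-indicator₂ : ∀ (f : ℕ → ℕ) {s t n} → s < t → t < n →
                 sum (applyUpTo (λ i → if (i ≡ᵇ s) ∨ (i ≡ᵇ t) then f i else 0) n) ≡ f s + f t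
sum-indicator₂ f {zero}  {suc t} {suc n} _         (s≤s t<n) = cong (f 0 +_) (sum-indicator (f ∘ suc) t<n)
sum-indicator₂ f {suc s} {suc t} {suc n} (s≤s s<t) (s≤s t<n) = sum-indicator₂ (f ∘ suc) s<t t<n

-- Inner points

four-cells : ∀ b x y → ((b <ᵇ x) ∧ (b <ᵇ y) ∧ (suc b <ᵇ x) ∧ (suc b <ᵇ y)) ≡ (suc b <ᵇ x ⊓ y)
four-cells b       zero          y             = refl
four-cells b       (suc x)       zero          = ∧-zeroʳ (b <ᵇ suc x)
four-cells zero    (suc zero)    (suc y)       = refl
four-cells zero    (suc (suc x)) (suc zero)    = refl
four-cells zero    (suc (suc x)) (suc (suc y)) = refl
four-cells (suc b) (suc x)       (suc y)       = four-cells b x y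

count-suc<ᵇ : ∀ m M → count (applyUpTo (λ b → suc b <ᵇ m) M) ≡ (m ∸ 1) ⊓ M
count-suc<ᵇ m             zero    = sym (⊓-zeroʳ (m ∸ 1))
count-suc<ᵇ zero          (suc M) = count-suc<ᵇ zero M
count-suc<ᵇ (suc zero)    (suc M) = count-suc<ᵇ 1 M
count-suc<ᵇ (suc (suc m)) (suc M) = cong suc (count-suc<ᵇ (suc m) M)

height≤maxH : ∀ w c → height w c ≤ maxH w
height≤maxH []      c       = z≤n
height≤maxH (h ∷ w) zero    = m≤m⊔n h (maxH w)
height≤maxH (h ∷ w) (suc c) = ≤-trans (height≤maxH w c) (m≤n⊔m h (maxH w))

-- Adjacent columns of heights h and h′ have min(h, h′) - 1 inner points on their common side.
inn′ : List ℕ → ℕ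
inn′ []      = 0
inn′ (h ∷ w) = h ⊓ height w 0 ∸ 1 + inn′ w

column-inn : ∀ w a → count (map (innerAt w (suc a)) (upTo (suc (maxH w)))) ≡ height w a ⊓ height w (suc a) ∸ 1
column-inn w a = begin
  count (map (innerAt w (suc a)) (upTo (suc M)))  ≡⟨ cong count (map-upTo (innerAt w (suc a)) (suc M)) ⟩
  count (applyUpTo (innerAt w (suc a)) (suc M))   ≡⟨ cong count (applyUpTo-cong (λ b → four-cells b x y) M) ⟩
  count (applyUpTo (λ b → suc b <ᵇ x ⊓ y) M)      ≡⟨ count-suc<ᵇ (x ⊓ y) M ⟩
  (x ⊓ y ∸ 1) ⊓ M                                 ≡⟨ m≤n⇒m⊓n≡m x⊓y∸1≤M ⟩
  x ⊓ y ∸ 1                                       ∎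
  where
  open ≡-Reasoning
  M = maxH w
  x = height w a
  y = height w (suc a)
  x⊓y∸1≤M : x ⊓ y ∸ 1 ≤ M
  x⊓y∸1≤M = ≤-trans (m∸n≤m (x ⊓ y) 1) (≤-trans (m⊓n≤m x y) (height≤maxH w a))

sum-adjacent-inn : ∀ w → sum (applyUpTo (λ a → height w a ⊓ height w (suc a) ∸ 1) (length w)) ≡ inn′ w
sum-adjacent-inn []      = refl
sum-adjacent-inn (h ∷ w) = cong (h ⊓ height w 0 ∸ 1 +_) (sum-adjacent-inn w)

inn≡inn′ : ∀ w → inn w ≡ inn′ w
inn≡inn′ w = begin
  inn w
    ≡⟨ count-concatMap column (upTo (suc (length w))) ⟩
  sum (map (count ∘ column) (upTo (suc (length w))))
    ≡⟨ cong sum (map-upTo (count ∘ column) (suc (length w))) ⟩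
  count (map (λ _ → false) (upTo (suc M))) + sum (applyUpTo (count ∘ column ∘ suc) (length w))
    ≡⟨ cong₂ _+_ (count-map-false (upTo (suc M))) (cong sum (applyUpTo-cong (column-inn w) (length w))) ⟩
  sum (applyUpTo (λ a → height w a ⊓ height w (suc a) ∸ 1) (length w))
    ≡⟨ sum-adjacent-inn w ⟩
  inn′ w ∎
  where
  open ≡-Reasoning
  M = maxH w
  column : ℕ → List Bool
  column a = map (innerAt w a) (upTo (suc M))

-- Series with natural coefficients

Seriesℕ : Set
Seriesℕ = ℕ → ℕ → ℕ

infix 4 _≐_
_≐_ : Seriesℕ → Seriesℕ → Set
X ≐ Y = ∀ n k → X n k ≡ Y n k

infixl 6 _⊞_
_⊞_ : Seriesℕ → Seriesℕ → Seriesℕ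
(X ⊞ Y) n k = X n k + Y n k

𝟘 : Seriesℕ
𝟘 n k = 0

δ : Seriesℕ
δ n k = if (n ≡ᵇ 0) ∧ (k ≡ᵇ 0) then 1 else 0

sumSeriesℕ : ℕ → (ℕ → Seriesℕ) → Seriesℕ
sumSeriesℕ zero    F = 𝟘
sumSeriesℕ (suc r) F = sumSeriesℕ r F ⊞ F (suc r)

sumSeriesℕ-cong : ∀ r {F G : ℕ → Seriesℕ} n k → (∀ i → 1 ≤ i → i ≤ r → F i n k ≡ G i n k) →
                  sumSeriesℕ r F n k ≡ sumSeriesℕ r G n k
sumSeriesℕ-cong zero    n k F≐G = refl
sumSeriesℕ-cong (suc r) n k F≐G =
  cong₂ _+_ (sumSeriesℕ-cong r n k (λ i 1≤i i≤r → F≐G i 1≤i (m≤n⇒m≤1+n i≤r)))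
            (F≐G (suc r) (s≤s z≤n) ≤-refl)

sumSeriesℕ-⊞ : ∀ r (F G : ℕ → Seriesℕ) →
               sumSeriesℕ r (λ i → F i ⊞ G i) ≐ sumSeriesℕ r F ⊞ sumSeriesℕ r G
sumSeriesℕ-⊞ zero    F G n k = refl
sumSeriesℕ-⊞ (suc r) F G n k = begin
  sumSeriesℕ r (λ i → F i ⊞ G i) n k + (F (suc r) n k + G (suc r) n k)
    ≡⟨ cong (_+ (F (suc r) n k + G (suc r) n k)) (sumSeriesℕ-⊞ r F G n k) ⟩
  (sumSeriesℕ r F n k + sumSeriesℕ r G n k) + (F (suc r) n k + G (suc r) n k)
    ≡⟨ +-interchange (sumSeriesℕ r F n k) (sumSeriesℕ r G n k) (F (suc r) n k) (G (suc r) n k) ⟩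
  (sumSeriesℕ r F n k + F (suc r) n k) + (sumSeriesℕ r G n k + G (suc r) n k) ∎
  where open ≡-Reasoning

sumSeriesℕ-𝟘 : ∀ r → sumSeriesℕ r (λ _ → 𝟘) ≐ 𝟘
sumSeriesℕ-𝟘 zero    n k = refl
sumSeriesℕ-𝟘 (suc r) n k = trans (+-identityʳ _) (sumSeriesℕ-𝟘 r n k)

sumSeriesℕ-swap : ∀ r s (F : ℕ → ℕ → Seriesℕ) →
                  sumSeriesℕ r (λ i → sumSeriesℕ s (F i)) ≐ sumSeriesℕ s (λ j → sumSeriesℕ r (λ i → F i j))
sumSeriesℕ-swap r zero    F = sumSeriesℕ-𝟘 r
sumSeriesℕ-swap r (suc s) F n k =
  trans (sumSeriesℕ-⊞ r (λ i → sumSeriesℕ s (F i)) (λ i → F i (suc s)) n k)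
        (cong (_+ sumSeriesℕ r (λ i → F i (suc s)) n k) (sumSeriesℕ-swap r s F n k))

qshift : ℕ → (ℕ → ℕ) → ℕ → ℕ
qshift zero    g k       = g k
qshift (suc b) g zero    = 0
qshift (suc b) g (suc k) = qshift b g k

-- multiplication by the monomial x^a q^b
shift : ℕ → ℕ → Seriesℕ → Seriesℕ
shift zero    b X n       k = qshift b (X n) k
shift (suc a) b X zero    k = 0
shift (suc a) b X (suc n) k = shift a b X n k

qshift-cong : ∀ b {g h : ℕ → ℕ} → (∀ k → g k ≡ h k) → ∀ k → qshift b g k ≡ qshift b h k
qshift-cong zero    g≗h k       = g≗h k
qshift-cong (suc b) g≗h zero    = refl
qshift-cong (suc b) g≗h (suc k) = qshift-cong b g≗h k

qshift-zero : ∀ b k → qshift b (λ _ → 0) k ≡ 0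
qshift-zero zero    k       = refl
qshift-zero (suc b) zero    = refl
qshift-zero (suc b) (suc k) = qshift-zero b k

qshift-+ : ∀ b (g h : ℕ → ℕ) k → qshift b (λ k → g k + h k) k ≡ qshift b g k + qshift b h k
qshift-+ zero    g h k       = refl
qshift-+ (suc b) g h zero    = refl
qshift-+ (suc b) g h (suc k) = qshift-+ b g h k

qshift-qshift : ∀ b d (g : ℕ → ℕ) k → qshift b (qshift d g) k ≡ qshift (b + d) g k
qshift-qshift zero    d g k       = refl
qshift-qshift (suc b) d g zero    = refl
qshift-qshift (suc b) d g (suc k) = qshift-qshift b d g k

qshift-shift : ∀ b c d X n k → qshift b (shift c d X n) k ≡ shift c (b + d) X n k
qshift-shift b zero    d X n       k = qshift-qshift b d (X n) k
qshift-shift b (suc c) d X zero    k = qshift-zero b k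
qshift-shift b (suc c) d X (suc n) k = qshift-shift b c d X n k

shift-cong : ∀ a b {X Y} → X ≐ Y → shift a b X ≐ shift a b Y
shift-cong zero    b X≐Y n       k = qshift-cong b (X≐Y n) k
shift-cong (suc a) b X≐Y zero    k = refl
shift-cong (suc a) b X≐Y (suc n) k = shift-cong a b X≐Y n k

shift-⊞ : ∀ a b X Y → shift a b (X ⊞ Y) ≐ shift a b X ⊞ shift a b Y
shift-⊞ zero    b X Y n       k = qshift-+ b (X n) (Y n) k
shift-⊞ (suc a) b X Y zero    k = refl
shift-⊞ (suc a) b X Y (suc n) k = shift-⊞ a b X Y n k

shift-𝟘 : ∀ a b → shift a b 𝟘 ≐ 𝟘
shift-𝟘 zero    b n       k = qshift-zero b k
shift-𝟘 (suc a) b zero    k = refl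
shift-𝟘 (suc a) b (suc n) k = shift-𝟘 a b n k

shift-shift : ∀ a b c d X → shift a b (shift c d X) ≐ shift (a + c) (b + d) X
shift-shift zero    b c d X n       k = qshift-shift b c d X n k
shift-shift (suc a) b c d X zero    k = refl
shift-shift (suc a) b c d X (suc n) k = shift-shift a b c d X n k

shift-comm : ∀ a b c d X → shift a b (shift c d X) ≐ shift c d (shift a b X)
shift-comm a b c d X n k = begin
  shift a b (shift c d X) n k  ≡⟨ shift-shift a b c d X n k ⟩
  shift (a + c) (b + d) X n k  ≡⟨ cong₂ (λ x y → shift x y X n k) (+-comm a c) (+-comm b d) ⟩
  shift (c + a) (d + b) X n k  ≡⟨ shift-shift c d a b X n k ⟨
  shift c d (shift a b X) n k  ∎
  where open ≡-Reasoning

shift-sumSeriesℕ : ∀ a b r F → shift a b (sumSeriesℕ r F) ≐ sumSeriesℕ r (λ i → shift a b (F i))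
shift-sumSeriesℕ a b zero    F n k = shift-𝟘 a b n k
shift-sumSeriesℕ a b (suc r) F n k =
  trans (shift-⊞ a b (sumSeriesℕ r F) (F (suc r)) n k)
        (cong (_+ shift a b (F (suc r)) n k) (shift-sumSeriesℕ a b r F n k))

AgreeBelow : ℕ → Seriesℕ → Seriesℕ → Set
AgreeBelow n X Y = ∀ {m} → m < n → ∀ k → X m k ≡ Y m k

Causal : (Seriesℕ → Seriesℕ) → Set
Causal Φ = ∀ {X Y} n → AgreeBelow n X Y → ∀ k → Φ X n k ≡ Φ Y n k

shift-causal : ∀ a b → 1 ≤ a → Causal (shift a b)
shift-causal (suc a) b _ zero    agree k = refl
shift-causal (suc a) b _ (suc n) agree k = go a n agree k
  where
  go : ∀ a {X Y} n → AgreeBelow (suc n) X Y → ∀ k → shift a b X n k ≡ shift a b Y n k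
  go zero    n       agree k = qshift-cong b (agree ≤-refl) k
  go (suc a) zero    agree k = refl
  go (suc a) (suc n) agree k = go a n (λ m<n → agree (m<n⇒m<1+n m<n)) k

sumSeriesℕ-causal : ∀ r (Φ : ℕ → Seriesℕ → Seriesℕ) → (∀ i → Causal (Φ i)) →
                    Causal (λ X → sumSeriesℕ r (λ i → Φ i X))
sumSeriesℕ-causal zero    Φ Φ-causal n agree k = refl
sumSeriesℕ-causal (suc r) Φ Φ-causal n agree k =
  cong₂ _+_ (sumSeriesℕ-causal r Φ Φ-causal n agree k) (Φ-causal (suc r) n agree k)

causal-unique : ∀ {Φ A X Y} → Causal Φ → X ≐ A ⊞ Φ X → Y ≐ A ⊞ Φ Y → X ≐ Y
causal-unique {Φ} {A} {X} {Y} Φ-causal X-fix Y-fix = <-rec (λ n → ∀ k → X n k ≡ Y n k) step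
  where
  step : ∀ n → AgreeBelow n X Y → ∀ k → X n k ≡ Y n k
  step n agree k = begin
    X n k            ≡⟨ X-fix n k ⟩
    A n k + Φ X n k  ≡⟨ cong (A n k +_) (Φ-causal n agree k) ⟩
    A n k + Φ Y n k  ≡⟨ Y-fix n k ⟨
    Y n k            ∎
    where open ≡-Reasoning

causal-solution : ∀ {Φ} → Causal Φ → ∀ A → Σ Seriesℕ (λ X → X ≐ A ⊞ Φ X)
causal-solution {Φ} Φ-causal A = X , X-fix
  where
  approx : ℕ → Seriesℕ
  approx zero    = 𝟘
  approx (suc t) = A ⊞ Φ (approx t)

  -- by causality, row n of approx t is the same for all t > n
  X : Seriesℕ
  X n = approx (suc n) n

  approx-stable : ∀ n {t} → n < t → ∀ k → approx t n k ≡ X n k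
  approx-stable = <-rec (λ n → ∀ {t} → n < t → ∀ k → approx t n k ≡ X n k) step
    where
    step : ∀ n → (∀ {m} → m < n → ∀ {t} → m < t → ∀ k → approx t m k ≡ X m k) →
           ∀ {t} → n < t → ∀ k → approx t n k ≡ X n k
    step n stable {suc t} (s≤s n≤t) k = cong (A n k +_) (Φ-causal n agree k)
      where
      agree : AgreeBelow n (approx t) (approx n)
      agree m<n k = trans (stable m<n (<-≤-trans m<n n≤t) k) (sym (stable m<n m<n k))

  X-fix : X ≐ A ⊞ Φ X
  X-fix n k = cong (A n k +_) (Φ-causal n (λ m<n → approx-stable _ m<n) k)

mulPoly : ℕ → (ℕ → ℕ) → (ℕ → ℕ) → Seriesℕ → Seriesℕ
mulPoly r a b X = sumSeriesℕ r (λ i → shift (a i) (b i) X)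

mulPoly-cong : ∀ r a b {X Y} → X ≐ Y → mulPoly r a b X ≐ mulPoly r a b Y
mulPoly-cong r a b X≐Y n k = sumSeriesℕ-cong r n k (λ i _ _ → shift-cong (a i) (b i) X≐Y n k)

mulPoly-⊞ : ∀ r a b X Y → mulPoly r a b (X ⊞ Y) ≐ mulPoly r a b X ⊞ mulPoly r a b Y
mulPoly-⊞ r a b X Y n k =
  trans (sumSeriesℕ-cong r n k (λ i _ _ → shift-⊞ (a i) (b i) X Y n k))
        (sumSeriesℕ-⊞ r (λ i → shift (a i) (b i) X) (λ i → shift (a i) (b i) Y) n k)

mulPoly-comm : ∀ r a b s c d X → mulPoly r a b (mulPoly s c d X) ≐ mulPoly s c d (mulPoly r a b X)
mulPoly-comm r a b s c d X n k = begin
  mulPoly r a b (mulPoly s c d X) n k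
    ≡⟨ sumSeriesℕ-cong r n k (λ i _ _ → shift-sumSeriesℕ (a i) (b i) s _ n k) ⟩
  sumSeriesℕ r (λ i → sumSeriesℕ s (λ j → shift (a i) (b i) (shift (c j) (d j) X))) n k
    ≡⟨ sumSeriesℕ-cong r n k (λ i _ _ → sumSeriesℕ-cong s n k (λ j _ _ → shift-comm (a i) (b i) (c j) (d j) X n k)) ⟩
  sumSeriesℕ r (λ i → sumSeriesℕ s (λ j → shift (c j) (d j) (shift (a i) (b i) X))) n k
    ≡⟨ sumSeriesℕ-swap r s _ n k ⟩
  sumSeriesℕ s (λ j → sumSeriesℕ r (λ i → shift (c j) (d j) (shift (a i) (b i) X))) n k
    ≡⟨ sumSeriesℕ-cong s n k (λ j _ _ → shift-sumSeriesℕ (c j) (d j) r _ n k) ⟨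
  mulPoly s c d (mulPoly r a b X) n k ∎
  where open ≡-Reasoning

mulPoly-causal : ∀ r a b → (∀ i → 1 ≤ a i) → Causal (mulPoly r a b)
mulPoly-causal r a b 1≤a = sumSeriesℕ-causal r (λ i → shift (a i) (b i)) (λ i → shift-causal (a i) (b i) (1≤a i))

mulPoly-solution : ∀ r a b s c d {A X} → X ≐ A ⊞ mulPoly r a b X →
                   mulPoly s c d X ≐ mulPoly s c d A ⊞ mulPoly r a b (mulPoly s c d X)
mulPoly-solution r a b s c d {A} {X} X-fix n k = begin
  Q X n k                  ≡⟨ mulPoly-cong s c d X-fix n k ⟩
  Q (A ⊞ P X) n k          ≡⟨ mulPoly-⊞ s c d A (P X) n k ⟩
  Q A n k + Q (P X) n k    ≡⟨ cong (Q A n k +_) (mulPoly-comm s c d r a b X n k) ⟩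
  Q A n k + P (Q X) n k    ∎
  where
  open ≡-Reasoning
  P Q : Seriesℕ → Seriesℕ
  P = mulPoly r a b
  Q = mulPoly s c d

-- Integer series

toSeries : Seriesℕ → Series
toSeries X n k = ℤ.+ X n k

toSeries-δ : toSeries δ ≈ one
toSeries-δ n k = if-float ℤ.+_ ((n ≡ᵇ 0) ∧ (k ≡ᵇ 0))

sumTo-cong : ∀ n {f g : ℕ → ℤ} → (∀ i → i ≤ n → f i ≡ g i) → sumTo n f ≡ sumTo n g
sumTo-cong zero    f≗g = f≗g 0 z≤n
sumTo-cong (suc n) f≗g =
  cong₂ ℤ._+_ (sumTo-cong n (λ i i≤n → f≗g i (m≤n⇒m≤1+n i≤n))) (f≗g (suc n) ≤-refl)

sumTo-zero : ∀ n {f : ℕ → ℤ} → (∀ i → f i ≡ ℤ.+ 0) → sumTo n f ≡ ℤ.+ 0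
sumTo-zero zero    f≗0 = f≗0 0
sumTo-zero (suc n) f≗0 = cong₂ ℤ._+_ (sumTo-zero n f≗0) (f≗0 (suc n))

sumTo-head : ∀ n {f : ℕ → ℤ} → (∀ i → f (suc i) ≡ ℤ.+ 0) → sumTo n f ≡ f 0
sumTo-head zero        f≗0 = refl
sumTo-head (suc n) {f} f≗0 = trans (cong₂ ℤ._+_ (sumTo-head n f≗0) (f≗0 n)) (ℤ.+-identityʳ (f 0))

sumTo-suc : ∀ n (f : ℕ → ℤ) → sumTo (suc n) f ≡ f 0 ℤ.+ sumTo n (f ∘ suc)
sumTo-suc zero    f = refl
sumTo-suc (suc n) f =
  trans (cong (ℤ._+ f (suc (suc n))) (sumTo-suc n f)) (ℤ.+-assoc (f 0) (sumTo n (f ∘ suc)) (f (suc (suc n))))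

sumTo-reverse : ∀ n (f : ℕ → ℤ) → sumTo n f ≡ sumTo n (λ i → f (n ∸ i))
sumTo-reverse zero    f = refl
sumTo-reverse (suc n) f = begin
  sumTo n f ℤ.+ f (suc n)                  ≡⟨ cong (ℤ._+ f (suc n)) (sumTo-reverse n f) ⟩
  sumTo n (λ i → f (n ∸ i)) ℤ.+ f (suc n)  ≡⟨ ℤ.+-comm (sumTo n (λ i → f (n ∸ i))) (f (suc n)) ⟩
  f (suc n) ℤ.+ sumTo n (λ i → f (n ∸ i))  ≡⟨ sumTo-suc n (λ i → f (suc n ∸ i)) ⟨
  sumTo (suc n) (λ i → f (suc n ∸ i))      ∎
  where open ≡-Reasoning

sumTo-+ : ∀ n (f g : ℕ → ℤ) → sumTo n (λ i → f i ℤ.+ g i) ≡ sumTo n f ℤ.+ sumTo n g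
sumTo-+ zero    f g = refl
sumTo-+ (suc n) f g =
  trans (cong (ℤ._+ (f (suc n) ℤ.+ g (suc n))) (sumTo-+ n f g))
        (+ℤ-interchange (sumTo n f) (sumTo n g) (f (suc n)) (g (suc n)))

sumTo-neg : ∀ n (f : ℕ → ℤ) → sumTo n (λ i → ℤ.- f i) ≡ ℤ.- sumTo n f
sumTo-neg zero    f = refl
sumTo-neg (suc n) f =
  trans (cong (ℤ._+ ℤ.- f (suc n)) (sumTo-neg n f)) (sym (ℤ.neg-distrib-+ (sumTo n f) (f (suc n))))

⊛-comm : ∀ f g → (f ⊛ g) ≈ (g ⊛ f)
⊛-comm f g n k = begin
  sumTo n (λ i → sumTo k (λ j → f i j ℤ.* g (n ∸ i) (k ∸ j)))
    ≡⟨ sumTo-reverse n _ ⟩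
  sumTo n (λ i → sumTo k (λ j → f (n ∸ i) j ℤ.* g (n ∸ (n ∸ i)) (k ∸ j)))
    ≡⟨ sumTo-cong n (λ i i≤n → trans (sumTo-reverse k _) (sumTo-cong k (λ j j≤k → swap i≤n j≤k))) ⟩
  sumTo n (λ i → sumTo k (λ j → g i j ℤ.* f (n ∸ i) (k ∸ j))) ∎
  where
  open ≡-Reasoning
  swap : ∀ {i j} → i ≤ n → j ≤ k →
         f (n ∸ i) (k ∸ j) ℤ.* g (n ∸ (n ∸ i)) (k ∸ (k ∸ j)) ≡ g i j ℤ.* f (n ∸ i) (k ∸ j)
  swap {i} {j} i≤n j≤k =
    trans (cong₂ (λ a b → f (n ∸ i) (k ∸ j) ℤ.* g a b) (m∸[m∸n]≡n i≤n) (m∸[m∸n]≡n j≤k))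
          (ℤ.*-comm (f (n ∸ i) (k ∸ j)) (g i j))

⊛-⊕ˡ : ∀ f g h → ((f ⊕ g) ⊛ h) ≈ ((f ⊛ h) ⊕ (g ⊛ h))
⊛-⊕ˡ f g h n k =
  trans (sumTo-cong n (λ i _ → trans (sumTo-cong k (λ j _ → ℤ.*-distribʳ-+ (h (n ∸ i) (k ∸ j)) (f i j) (g i j)))
                                      (sumTo-+ k _ _)))
        (sumTo-+ n _ _)

⊛-⊖ˡ : ∀ f g h → ((f ⊖ g) ⊛ h) ≈ ((f ⊛ h) ⊖ (g ⊛ h))
⊛-⊖ˡ f g h n k = trans (⊛-⊕ˡ f (λ n k → ℤ.- g n k) h n k) (cong (ℤ._+_ ((f ⊛ h) n k)) ⊛-negˡ)
  where
  ⊛-negˡ : ((λ n k → ℤ.- g n k) ⊛ h) n k ≡ ℤ.- (g ⊛ h) n k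
  ⊛-negˡ = trans (sumTo-cong n (λ i _ → trans (sumTo-cong k (λ j _ → sym (ℤ.neg-distribˡ-* (g i j) _)))
                                               (sumTo-neg k _)))
                 (sumTo-neg n _)

zeroS-⊛ : ∀ f → (zeroS ⊛ f) ≈ zeroS
zeroS-⊛ f n k = sumTo-zero n (λ i → sumTo-zero k (λ j → refl))

mono-q⁰ : ∀ a b i x → mono a (suc b) i 0 ℤ.* x ≡ ℤ.+ 0
mono-q⁰ a b i x = cong (λ c → (if c then ℤ.+ 1 else ℤ.+ 0) ℤ.* x) (∧-zeroʳ (i ≡ᵇ a))

-- Each unit of a (of b) removes the terms i = 0 (j = 0) of the Cauchy product and shifts the others.
mono-⊛ : ∀ a b X → (mono a b ⊛ toSeries X) ≈ toSeries (shift a b X)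
mono-⊛ (suc a) b X zero    k = sumTo-zero k (λ j → refl)
mono-⊛ (suc a) b X (suc n) k =
  trans (sumTo-suc n _) (cong₂ ℤ._+_ (sumTo-zero k (λ j → refl)) (mono-⊛ a b X n k))
mono-⊛ zero (suc b) X n zero    = sumTo-zero n (λ i → mono-q⁰ 0 b i _)
mono-⊛ zero (suc b) X n (suc k) = trans (sumTo-cong n (λ i _ → drop-q⁰ i)) (mono-⊛ zero b X n k)
  where
  drop-q⁰ : ∀ i → sumTo (suc k) (λ j → mono 0 (suc b) i j ℤ.* ℤ.+ X (n ∸ i) (suc k ∸ j)) ≡
                  sumTo k (λ j → mono 0 b i j ℤ.* ℤ.+ X (n ∸ i) (k ∸ j))
  drop-q⁰ i = trans (sumTo-suc k _)
                    (trans (cong (ℤ._+ sumTo k (λ j → mono 0 b i j ℤ.* ℤ.+ X (n ∸ i) (k ∸ j)))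
                                 (mono-q⁰ 0 b i (ℤ.+ X (n ∸ i) (suc k))))
                           (ℤ.+-identityˡ _))
mono-⊛ zero zero X n k =
  trans (sumTo-head n (λ i → sumTo-zero k (λ j → refl)))
        (trans (sumTo-head k (λ j → refl)) (ℤ.*-identityˡ (ℤ.+ X n k)))

sumMono-⊛ : ∀ r a b X → (sumSeries r (λ i → mono (a i) (b i)) ⊛ toSeries X) ≈ toSeries (mulPoly r a b X)
sumMono-⊛ zero    a b X n k = zeroS-⊛ (toSeries X) n k
sumMono-⊛ (suc r) a b X n k =
  trans (⊛-⊕ˡ (sumSeries r (λ i → mono (a i) (b i))) (mono (a (suc r)) (b (suc r))) (toSeries X) n k)
        (cong₂ ℤ._+_ (sumMono-⊛ r a b X n k) (mono-⊛ (a (suc r)) (b (suc r)) X n k))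

toSeries-solves : ∀ r a b {A X} → X ≐ A ⊞ mulPoly r a b X →
                  (toSeries X ⊛ (one ⊖ sumSeries r (λ i → mono (a i) (b i)))) ≈ toSeries A
toSeries-solves r a b {A} {X} X-fix n k = begin
  (toSeries X ⊛ (one ⊖ P)) n k                       ≡⟨ ⊛-comm (toSeries X) (one ⊖ P) n k ⟩
  ((one ⊖ P) ⊛ toSeries X) n k                       ≡⟨ ⊛-⊖ˡ one P (toSeries X) n k ⟩
  (one ⊛ toSeries X) n k ℤ.- (P ⊛ toSeries X) n k    ≡⟨ cong₂ ℤ._-_ (mono-⊛ 0 0 X n k) (sumMono-⊛ r a b X n k) ⟩
  ℤ.+ X n k ℤ.- ℤ.+ M                                ≡⟨ cong (λ m → ℤ.+ m ℤ.- ℤ.+ M) (X-fix n k) ⟩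
  (ℤ.+ A n k ℤ.+ ℤ.+ M) ℤ.- ℤ.+ M                    ≡⟨ ℤ.+-assoc (ℤ.+ A n k) (ℤ.+ M) (ℤ.- ℤ.+ M) ⟩
  ℤ.+ A n k ℤ.+ (ℤ.+ M ℤ.- ℤ.+ M)                    ≡⟨ cong (ℤ._+_ (ℤ.+ A n k)) (ℤ.+-inverseʳ (ℤ.+ M)) ⟩
  ℤ.+ A n k ℤ.+ ℤ.+ 0                                ≡⟨ ℤ.+-identityʳ (ℤ.+ A n k) ⟩
  ℤ.+ A n k                                          ∎
  where
  open ≡-Reasoning
  P : Series
  P = sumSeries r (λ i → mono (a i) (b i))
  M : ℕ
  M = mulPoly r a b X n k

-- p-Fibonacci words

-- the number of inner points of the descending run i + j, i + j - 1, …, i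
run : ℕ → ℕ → ℕ
run i zero    = 0
run i (suc j) = run i j + (i ∸ 1 + j)

twice-run-suc : ∀ i j → 2 * run (suc i) (suc j) ≡ suc j * (j + 2 * i)
twice-run-suc i zero    = begin
  2 * (i + 0)  ≡⟨ solve (i ∷ []) ⟩
  1 * (2 * i)  ∎
  where open ≡-Reasoning
twice-run-suc i (suc j) = begin
  2 * (run (suc i) (suc j) + (i + suc j))      ≡⟨ *-distribˡ-+ 2 (run (suc i) (suc j)) (i + suc j) ⟩
  2 * run (suc i) (suc j) + 2 * (i + suc j)    ≡⟨ cong (_+ 2 * (i + suc j)) (twice-run-suc i j) ⟩
  suc j * (j + 2 * i) + 2 * (i + suc j)        ≡⟨ solve (i ∷ j ∷ []) ⟩
  suc (suc j) * (suc j + 2 * i)                ∎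
  where open ≡-Reasoning

twice-run : ∀ i j → 2 * run (suc i) j ≡ j * (j + suc i + suc i ∸ 3)
twice-run i zero    = refl
twice-run i (suc j) = begin
  2 * run (suc i) (suc j)              ≡⟨ twice-run-suc i j ⟩
  suc j * (j + 2 * i)                  ≡⟨ cong (λ m → suc j * (m ∸ 3)) rearrange ⟩
  suc j * (suc j + suc i + suc i ∸ 3)  ∎
  where
  open ≡-Reasoning
  rearrange : 3 + (j + 2 * i) ≡ suc j + suc i + suc i
  rearrange = solve (i ∷ j ∷ [])

exponent-product : ∀ p i → 1 ≤ i → i ≤ p → (p ∸ i) * (p + i ∸ 3) ≡ 2 * run i (p ∸ i)
exponent-product p (suc i) _ i<p = begin
  (p ∸ suc i) * (p + suc i ∸ 3)                          ≡⟨ cong (λ m → (p ∸ suc i) * (m + suc i ∸ 3)) (m∸n+n≡m i<p) ⟨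
  (p ∸ suc i) * ((p ∸ suc i) + suc i + suc i ∸ 3)        ≡⟨ twice-run i (p ∸ suc i) ⟨
  2 * run (suc i) (p ∸ suc i)                            ∎
  where open ≡-Reasoning

half-double : ∀ m → 2 * m / 2 ≡ m
half-double m = trans (cong (_/ 2) (*-comm 2 m)) (m*n/n≡m m 2)

-- Num p and Den p unfold to sumSeries p (λ i → mono (p ∸ i + 1) (numExp p i)), resp. denExp.
numExp denExp : ℕ → ℕ → ℕ
numExp p i = ((p ∸ i) * (p + i ∸ 3)) / 2
denExp p i = ((p ∸ i) * (p + i ∸ 3) + 2 * (i ∸ 1)) / 2

numExp≡run : ∀ p i → 1 ≤ i → i ≤ p → numExp p i ≡ run i (p ∸ i)
numExp≡run p i 1≤i i≤p = trans (cong (_/ 2) (exponent-product p i 1≤i i≤p)) (half-double (run i (p ∸ i)))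

denExp≡run : ∀ p i → 1 ≤ i → i ≤ p → denExp p i ≡ run i (p ∸ i) + (i ∸ 1)
denExp≡run p i 1≤i i≤p = begin
  ((p ∸ i) * (p + i ∸ 3) + 2 * (i ∸ 1)) / 2  ≡⟨ cong (λ m → (m + 2 * (i ∸ 1)) / 2) (exponent-product p i 1≤i i≤p) ⟩
  (2 * run i (p ∸ i) + 2 * (i ∸ 1)) / 2      ≡⟨ cong (_/ 2) (*-distribˡ-+ 2 (run i (p ∸ i)) (i ∸ 1)) ⟨
  2 * (run i (p ∸ i) + (i ∸ 1)) / 2          ≡⟨ half-double (run i (p ∸ i) + (i ∸ 1)) ⟩
  run i (p ∸ i) + (i ∸ 1)                    ∎
  where open ≡-Reasoning

run-extend : ∀ {i c} → i ≤ c → c + run (suc i) (c ∸ i) ≡ run (suc i) (suc c ∸ i)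
run-extend {i} {c} i≤c = begin
  c + run (suc i) (c ∸ i)              ≡⟨ +-comm c _ ⟩
  run (suc i) (c ∸ i) + c              ≡⟨ cong (run (suc i) (c ∸ i) +_) (m+[n∸m]≡n i≤c) ⟨
  run (suc i) (suc (c ∸ i))            ≡⟨ cong (run (suc i)) (+-∸-assoc 1 i≤c) ⟨
  run (suc i) (suc c ∸ i)              ∎
  where open ≡-Reasoning

count-shift : ∀ {A : Set} (B : A → Bool) (v : A → ℕ) s xs k →
              count (map (λ x → B x ∧ (s + v x ≡ᵇ k)) xs) ≡
              qshift s (λ k′ → count (map (λ x → B x ∧ (v x ≡ᵇ k′)) xs)) k
count-shift B v zero    xs k       = refl
count-shift B v (suc s) xs zero    = trans (cong count (map-cong (λ x → ∧-zeroʳ (B x)) xs)) (count-map-false xs)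
count-shift B v (suc s) xs (suc k) = count-shift B v s xs k

module FibonacciWords (p′ : ℕ) where

  p : ℕ
  p = suc p′

  width : ℕ → ℕ
  width i = p ∸ i + 1

  -- startingWith c n k counts the words c ∷ w with n letters, all transitions allowed, and k inner points
  startingWith : ℕ → Seriesℕ
  startingWith c zero    k = 0
  startingWith c (suc m) k = count (map (λ w → fibChain p c w ∧ (inn′ (c ∷ w) ≡ᵇ k)) (words p m))

  count-words-suc : ∀ m (P : List ℕ → Bool) →
                    count (map P (words p (suc m))) ≡
                    sum (applyUpTo (λ i → count (map (P ∘ (suc i ∷_)) (words p m))) p)
  count-words-suc m P = begin
    count (map P (concatMap prefix (map suc (upTo p))))
      ≡⟨ cong count (map-concatMap P prefix (map suc (upTo p))) ⟩
    count (concatMap (map P ∘ prefix) (map suc (upTo p)))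
      ≡⟨ count-concatMap (map P ∘ prefix) (map suc (upTo p)) ⟩
    sum (map (count ∘ map P ∘ prefix) (map suc (upTo p)))
      ≡⟨ cong sum (map-∘ (upTo p)) ⟨
    sum (map (count ∘ map P ∘ prefix ∘ suc) (upTo p))
      ≡⟨ cong sum (map-upTo (count ∘ map P ∘ prefix ∘ suc) p) ⟩
    sum (applyUpTo (count ∘ map P ∘ prefix ∘ suc) p)
      ≡⟨ cong sum (applyUpTo-cong (λ i → cong count (map-∘ {g = P} {f = suc i ∷_} (words p m))) p) ⟨
    sum (applyUpTo (λ i → count (map (P ∘ (suc i ∷_)) (words p m))) p) ∎
    where
    open ≡-Reasoning
    prefix : ℕ → List (List ℕ)
    prefix a = map (a ∷_) (words p m)

  startingWith-singleton : ∀ c k → startingWith (suc c) 1 k ≡ δ 0 k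
  startingWith-singleton c zero    = refl
  startingWith-singleton c (suc k) = refl

  startingWith-second-letter :
    ∀ c m k → startingWith c (suc (suc m)) k ≡
              sum (applyUpTo (λ i → if fibStep p c (suc i)
                                    then count (map (λ w → fibChain p (suc i) w ∧ (inn′ (c ∷ suc i ∷ w) ≡ᵇ k)) (words p m))
                                    else 0) p)
  startingWith-second-letter c m k =
    trans (count-words-suc m _)
          (cong sum (applyUpTo-cong (λ i → count-map-∧ (fibStep p c (suc i)) (fibChain p (suc i))
                                                       (λ w → inn′ (c ∷ suc i ∷ w) ≡ᵇ k) (words p m)) p))

  startingWith-1 : startingWith 1 ≐ shift 1 0 δ ⊞ shift 1 0 (startingWith p)
  startingWith-1 zero          k = refl
  startingWith-1 (suc zero)    k = trans (startingWith-singleton 0 k) (sym (+-identityʳ (δ 0 k)))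
  startingWith-1 (suc (suc m)) k =
    trans (startingWith-second-letter 1 m k)
          (sum-indicator (λ i → count (map (λ w → fibChain p (suc i) w ∧ (inn′ (1 ∷ suc i ∷ w) ≡ᵇ k)) (words p m))) ≤-refl)

  startingWith-2+ : ∀ c → suc (suc c) ≤ p →
                    startingWith (suc (suc c)) ≐
                    shift 1 c (startingWith (suc c)) ⊞ (shift 1 0 δ ⊞ shift 1 (suc c) (startingWith p))
  startingWith-2+ c _ zero       k = refl
  startingWith-2+ c _ (suc zero) k =
    trans (startingWith-singleton (suc c) k)
          (sym (cong₂ _+_ (qshift-zero c k) (trans (cong (δ 0 k +_) (qshift-zero (suc c) k)) (+-identityʳ (δ 0 k)))))
  startingWith-2+ c (s≤s c<p′) (suc (suc m)) k = begin
    startingWith (suc (suc c)) (suc (suc m)) k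
      ≡⟨ startingWith-second-letter (suc (suc c)) m k ⟩
    sum (applyUpTo (λ i → if (i ≡ᵇ c) ∨ (i ≡ᵇ p′) then after i else 0) p)
      ≡⟨ sum-indicator₂ after c<p′ ≤-refl ⟩
    after c + after p′
      ≡⟨ cong₂ _+_ (trans (count-shift _ (inn′ ∘ (suc c ∷_)) (suc c ⊓ c) (words p m) k)
                          (cong (λ s → qshift s (startingWith (suc c) (suc m)) k) (m≥n⇒m⊓n≡n (n≤1+n c))))
                   (trans (count-shift _ (inn′ ∘ (p ∷_)) (suc c ⊓ p′) (words p m) k)
                          (cong (λ s → qshift s (startingWith p (suc m)) k) (m≤n⇒m⊓n≡m c<p′))) ⟩
    qshift c (startingWith (suc c) (suc m)) k + qshift (suc c) (startingWith p (suc m)) k ∎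
    where
    open ≡-Reasoning
    after : ℕ → ℕ
    after i = count (map (λ w → fibChain p (suc i) w ∧ (inn′ (suc (suc c) ∷ suc i ∷ w) ≡ᵇ k)) (words p m))

  -- a descending run c, c - 1, …, i, followed either by the end of the word or by the letter p
  block : ℕ → ℕ → Seriesℕ
  block c i = shift (c ∸ i + 1) (run i (c ∸ i)) δ ⊞ shift (c ∸ i + 1) (run i (c ∸ i) + (i ∸ 1)) (startingWith p)

  block-last : ∀ c → block c c ≐ shift 1 0 δ ⊞ shift 1 (c ∸ 1) (startingWith p)
  block-last c n k rewrite n∸n≡0 c = refl

  block-extend : ∀ c i → 1 ≤ i → i ≤ suc c → shift 1 c (block (suc c) i) ≐ block (suc (suc c)) i
  block-extend c (suc i) _ (s≤s i≤c) n k = begin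
    shift 1 c (block (suc c) (suc i)) n k
      ≡⟨ shift-⊞ 1 c (shift w r δ) (shift w (r + i) (startingWith p)) n k ⟩
    shift 1 c (shift w r δ) n k + shift 1 c (shift w (r + i) (startingWith p)) n k
      ≡⟨ cong₂ _+_ (shift-shift 1 c w r δ n k) (shift-shift 1 c w (r + i) (startingWith p) n k) ⟩
    shift (1 + w) (c + r) δ n k + shift (1 + w) (c + (r + i)) (startingWith p) n k
      ≡⟨ cong₂ _+_ (cong₂ (λ a b → shift a b δ n k) longer (run-extend i≤c))
                   (cong₂ (λ a b → shift a b (startingWith p) n k) longer
                          (trans (sym (+-assoc c r i)) (cong (_+ i) (run-extend i≤c)))) ⟩
    block (suc (suc c)) (suc i) n k ∎
    where
    open ≡-Reasoning
    w r : ℕ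
    w = c ∸ i + 1
    r = run (suc i) (c ∸ i)
    longer : 1 + w ≡ suc c ∸ i + 1
    longer = cong (_+ 1) (sym (+-∸-assoc 1 i≤c))

  startingWith-blocks : ∀ c → suc c ≤ p → startingWith (suc c) ≐ sumSeriesℕ (suc c) (block (suc c))
  startingWith-blocks zero    _      = startingWith-1
  startingWith-blocks (suc c) c+2≤p n k = begin
    startingWith (suc (suc c)) n k
      ≡⟨ startingWith-2+ c c+2≤p n k ⟩
    shift 1 c (startingWith (suc c)) n k + (shift 1 0 δ n k + shift 1 (suc c) (startingWith p) n k)
      ≡⟨ cong₂ _+_ earlier-blocks (sym (block-last (suc (suc c)) n k)) ⟩
    sumSeriesℕ (suc c) (block (suc (suc c))) n k + block (suc (suc c)) (suc (suc c)) n k ∎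
    where
    open ≡-Reasoning
    earlier-blocks : shift 1 c (startingWith (suc c)) n k ≡ sumSeriesℕ (suc c) (block (suc (suc c))) n k
    earlier-blocks = begin
      shift 1 c (startingWith (suc c)) n k
        ≡⟨ shift-cong 1 c (startingWith-blocks c (≤-trans (n≤1+n _) c+2≤p)) n k ⟩
      shift 1 c (sumSeriesℕ (suc c) (block (suc c))) n k
        ≡⟨ shift-sumSeriesℕ 1 c (suc c) (block (suc c)) n k ⟩
      sumSeriesℕ (suc c) (λ i → shift 1 c (block (suc c) i)) n k
        ≡⟨ sumSeriesℕ-cong (suc c) n k (λ i 1≤i i≤c+1 → block-extend c i 1≤i i≤c+1 n k) ⟩
      sumSeriesℕ (suc c) (block (suc (suc c))) n k ∎

  startingWith-p : startingWith p ≐ mulPoly p width (numExp p) δ ⊞ mulPoly p width (denExp p) (startingWith p)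
  startingWith-p n k = begin
    startingWith p n k
      ≡⟨ startingWith-blocks p′ ≤-refl n k ⟩
    sumSeriesℕ p (block p) n k
      ≡⟨ sumSeriesℕ-cong p n k (λ i 1≤i i≤p →
           cong₂ _+_ (cong (λ e → shift (width i) e δ n k) (sym (numExp≡run p i 1≤i i≤p)))
                     (cong (λ e → shift (width i) e (startingWith p) n k) (sym (denExp≡run p i 1≤i i≤p)))) ⟩
    sumSeriesℕ p (λ i → shift (width i) (numExp p i) δ ⊞ shift (width i) (denExp p i) (startingWith p)) n k
      ≡⟨ sumSeriesℕ-⊞ p _ _ n k ⟩
    mulPoly p width (numExp p) δ n k + mulPoly p width (denExp p) (startingWith p) n k ∎
    where open ≡-Reasoning

  countInn-startingWith : ∀ n k → countInn p n k ≡ δ n k + startingWith p n k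
  countInn-startingWith n k = begin
    countInn p n k
      ≡⟨ length-filter-filter (λ w → T? (isFib p w)) (λ w → inn w ≟ k) (words p n) ⟩
    count (map (λ w → isFib p w ∧ (inn w ≡ᵇ k)) (words p n))
      ≡⟨ cong count (map-cong (λ w → cong (λ m → isFib p w ∧ (m ≡ᵇ k)) (inn≡inn′ w)) (words p n)) ⟩
    count (map (λ w → isFib p w ∧ (inn′ w ≡ᵇ k)) (words p n))
      ≡⟨ by-length n k ⟩
    δ n k + startingWith p n k ∎
    where
    open ≡-Reasoning
    by-length : ∀ n k → count (map (λ w → isFib p w ∧ (inn′ w ≡ᵇ k)) (words p n)) ≡ δ n k + startingWith p n k
    by-length zero    zero    = refl
    by-length zero    (suc k) = refl
    by-length (suc m) k       =
      trans (count-words-suc m _)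
      (trans (cong sum (applyUpTo-cong (λ i → count-map-∧ (suc i ≡ᵇ p) (fibChain p (suc i))
                                                         (λ w → inn′ (suc i ∷ w) ≡ᵇ k) (words p m)) p))
             (sum-indicator (λ i → count (map (λ w → fibChain p (suc i) w ∧ (inn′ (suc i ∷ w) ≡ᵇ k)) (words p m))) ≤-refl))

theorem3 : (p : ℕ) → 1 ≤ p →
    Σ Series (λ H → (H ⊛ (one ⊖ Den p)) ≈ one × G p ≈ (one ⊕ (Num p ⊛ H)))
theorem3 (suc p′) _ = toSeries H , H-inverts , G-formula
  where
  open FibonacciWords p′

  D N : Seriesℕ → Seriesℕ
  D = mulPoly p width (denExp p)
  N = mulPoly p width (numExp p)

  D-causal : Causal D
  D-causal = mulPoly-causal p width (denExp p) (λ i → m≤n+m 1 (p ∸ i))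

  H : Seriesℕ
  H = proj₁ (causal-solution D-causal δ)

  H-fix : H ≐ δ ⊞ D H
  H-fix = proj₂ (causal-solution D-causal δ)

  startingWith≐NH : startingWith p ≐ N H
  startingWith≐NH = causal-unique {A = N δ} D-causal startingWith-p
                      (mulPoly-solution p width (denExp p) p width (numExp p) {A = δ} H-fix)

  H-inverts : (toSeries H ⊛ (one ⊖ Den p)) ≈ one
  H-inverts n k = trans (toSeries-solves p width (denExp p) {A = δ} H-fix n k) (toSeries-δ n k)

  G-formula : G p ≈ (one ⊕ (Num p ⊛ toSeries H))
  G-formula n k = begin
    ℤ.+ countInn p n k                        ≡⟨ cong ℤ.+_ (countInn-startingWith n k) ⟩
    ℤ.+ δ n k ℤ.+ ℤ.+ startingWith p n k      ≡⟨ cong (λ m → ℤ.+ δ n k ℤ.+ ℤ.+ m) (startingWith≐NH n k) ⟩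
    ℤ.+ δ n k ℤ.+ ℤ.+ N H n k                 ≡⟨ cong₂ ℤ._+_ (toSeries-δ n k) (sym (sumMono-⊛ p width (numExp p) H n k)) ⟩
    one n k ℤ.+ (Num p ⊛ toSeries H) n k      ∎
    where open ≡-Reasoning
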